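{- Let $G$ be the infinite square grid, i.e. the graph with vertex set $\mathbb{Z}^2$ in which $(a,b)$ and $(c,d)$ are adjacent if and only if $|a-c|+|b-d|=1$. Then $\overrightarrow{\beta}(G,1)=3$ (which is less than the maximum degree $4$ of $G$).
   Context: Firefighting on oriented graphs: an orientation $\overrightarrow{G}$ of a simple graph $G$ replaces each edge $uv$ by exactly one of the arcs $\overrightarrow{uv}$, $\overrightarrow{vu}$. Let $f\ge 1$ be an integer. A fire breaks out at a vertex $v$ at time $1$ ($v$ burns). At the end of each time unit, the firefighters permanently protect up to $f$ vertices that are neither burning nor already protected. At the next time unit, every vertex that is neither burning nor protected and is an out-neighbour of a burning vertex starts to burn. The process ends when no new vertex can burn (the number of burnt vertices may be infinite for infinite graphs). $\beta(\overrightarrow{G},f)$ is the supremum, over all starting vertices $v$, of the infimum, over all protection strategies, of the number of vertices that burn. $\overrightarrow{\beta}(G,f)$ is the infimum of $\beta(\overrightarrow{G},f)$ over all orientations $\overrightarrow{G}$ of $G$. -}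

module Defs where

open import Data.Nat using (ℕ; zero; suc; _+_; _≤_)
open import Data.Integer using (ℤ; _-_; ∣_∣)
open import Data.Product using (Σ; _×_; _,_)
open import Data.Sum using (_⊎_)
open import Data.Empty using (⊥)
open import Data.Maybe using (Maybe; just)
open import Data.List using (List; length)
open import Data.List.Membership.Propositional using (_∈_)
open import Data.List.Relation.Unary.All using (All)
open import Data.List.Relation.Unary.Unique.Propositional using (Unique)
open import Relation.Nullary using (¬_)
open import Relation.Binary.PropositionalEquality using (_≡_)

V : Set
V = ℤ × ℤ

Adj : V → V → Set
Adj (a , b) (c , d) = ∣ a - c ∣ + ∣ b - d ∣ ≡ 1

record Orientation : Set₁ where
  field
    Arc      : V → V → Set
    arc⇒adj  : ∀ u v → Arc u v → Adj u v
    oriented : ∀ u v → Adj u v → Arc u v ⊎ Arc v u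
    single   : ∀ u v → ¬ (Arc u v × Arc v u)
open Orientation public

-- A firefighter strategy with f = 1: at the end of time unit t (t = 0,1,2,…,
-- time 0 being the paper's time 1) protect at most one vertex.
Strategy : Set
Strategy = ℕ → Maybe V

module Process (O : Orientation) (v : V) (σ : Strategy) where
  Protected : ℕ → V → Set
  Burning   : ℕ → V → Set
  Protected zero    x = ⊥
  Protected (suc t) x = Protected t x ⊎ σ t ≡ just x
  Burning zero    x = x ≡ v
  Burning (suc t) x =
    Burning t x ⊎ (¬ Protected (suc t) x × Σ V (λ y → Burning t y × Arc O y x))

  Valid : Set
  Valid = ∀ t x → σ t ≡ just x → ¬ Burning t x × ¬ Protected t x

  Burnt : V → Set
  Burnt x = Σ ℕ (λ t → Burning t x)

  AtMostBurn : ℕ → Set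
  AtMostBurn n = Σ (List V) (λ L → length L ≤ n × (∀ x → Burnt x → x ∈ L))

  AtLeastBurn : ℕ → Set
  AtLeastBurn n = Σ (List V) (λ L → length L ≡ n × Unique L × All Burnt L)

βAtMost : Orientation → ℕ → Set
βAtMost O n = ∀ v → Σ Strategy (λ σ → Process.Valid O v σ × Process.AtMostBurn O v σ n)

βAtLeast : Orientation → ℕ → Set
βAtLeast O n = Σ V (λ v → ∀ σ → Process.Valid O v σ → Process.AtLeastBurn O v σ n)

module Submission where

-- Orient every horizontal edge westwards, and the vertical edges of each column
-- all southwards (even columns) or all northwards (odd columns).  A fire at v can then only
-- reach b = v + k (k the vertical direction of v's column) and c = b + W, provided the
-- firefighter protects v + W, b + k and c + W in turn; c's other out-neighbour is v + W again.
--
-- Call a vertex good if its out-degree is ≥ 3, or ≥ 2 with all out-neighbours of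
-- out-degree ≥ 2; a fire starting at a good vertex burns three vertices against any strategy.
-- Every orientation has a good vertex, by discharging in the square [0,14)²: were all its
-- vertices bad, the deficit 2 ∸ out-degree would total at most 28 there (each of its 364 edges
-- gives an out-arc), yet each of the 144 interior vertices sees positive deficit in its closed
-- neighbourhood, and these sums count every vertex at most 5 times, so 144 ≤ 5·28 = 140.

open import Defs
open import Data.Product using (Σ; ∃; _×_; _,_; proj₁; proj₂)
import Data.Product as Product
import Data.Product.Properties as Product
open import Data.Nat as ℕ using (ℕ; parity; zero; suc; z≤n; s≤s; _∸_; _≤_; _<_; _+_; _*_; _≤?_)
open import Data.Nat.Properties
open import Data.Nat.Tactic.RingSolver renaming (solve-∀ to ℕ-solve-∀)
open import Algebra.Properties.CommutativeSemigroup +-commutativeSemigroup using (interchange)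
open import Data.Integer as ℤ using (ℤ; +_; -[1+_]; 0ℤ; 1ℤ; -1ℤ; ∣_∣)
import Data.Integer.Properties as ℤ
open import Data.Integer.Tactic.RingSolver using (solve-∀)
open import Data.Parity.Base using (Parity; 0ℙ; 1ℙ; _⁻¹)
open import Data.Parity.Properties using (⁻¹-involutive; p≢p⁻¹; suc-homo-⁻¹)
open import Data.Sum using (_⊎_; inj₁; inj₂)
import Data.Sum as Sum
open import Data.Empty using (⊥-elim)
open import Data.Maybe using (just; nothing)
open import Data.Maybe.Properties using (just-injective)
import Data.Maybe.Properties as Maybe
open import Data.List using (List; []; _∷_; length; filter)
open import Data.List.Membership.Propositional using (_∈_)
open import Data.List.Membership.Propositional.Properties using (∈-filter⁻)
open import Data.List.Relation.Unary.Any using (here; there)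
open import Data.List.Relation.Unary.All using ([]; _∷_)
open import Data.List.Relation.Unary.AllPairs using ([]; _∷_)
open import Data.List.Relation.Unary.Unique.Propositional using (Unique)
open import Data.List.Relation.Unary.Unique.Propositional.Properties using (filter⁺)
open import Relation.Nullary using (¬_; Dec; yes; no)
open import Relation.Binary.PropositionalEquality
open import Function using (case_of_)

pred∘suc : ∀ a → -1ℤ ℤ.+ (1ℤ ℤ.+ a) ≡ a
pred∘suc = solve-∀

add-sub : ∀ k a → (k ℤ.+ a) ℤ.- a ≡ k
add-sub = solve-∀

suc∘pred : ∀ a → 1ℤ ℤ.+ (-1ℤ ℤ.+ a) ≡ a
suc∘pred = solve-∀

data Dir : Set where
  E W N S : Dir

nb : Dir → V → V
nb E (a , b) = (1ℤ ℤ.+ a , b)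
nb W (a , b) = (-1ℤ ℤ.+ a , b)
nb N (a , b) = (a , 1ℤ ℤ.+ b)
nb S (a , b) = (a , -1ℤ ℤ.+ b)

opp : Dir → Dir
opp E = W
opp W = E
opp N = S
opp S = N

opp≢ : ∀ d → opp d ≢ d
opp≢ E ()
opp≢ W ()
opp≢ N ()
opp≢ S ()

opp-involutive : ∀ d → opp (opp d) ≡ d
opp-involutive E = refl
opp-involutive W = refl
opp-involutive N = refl
opp-involutive S = refl

nb-opp : ∀ d u → nb (opp d) (nb d u) ≡ u
nb-opp E (a , b) = cong (_, b) (pred∘suc a)
nb-opp W (a , b) = cong (_, b) (suc∘pred a)
nb-opp N (a , b) = cong (a ,_) (pred∘suc b)
nb-opp S (a , b) = cong (a ,_) (suc∘pred b)

Δ : V → V → V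
Δ (c , d) (a , b) = (c ℤ.- a , d ℤ.- b)

unit : Dir → V
unit E = (1ℤ , 0ℤ)
unit W = (-1ℤ , 0ℤ)
unit N = (0ℤ , 1ℤ)
unit S = (0ℤ , -1ℤ)

Δ-nb : ∀ d u → Δ (nb d u) u ≡ unit d
Δ-nb E (a , b) = cong₂ _,_ (add-sub 1ℤ a) (ℤ.+-inverseʳ b)
Δ-nb W (a , b) = cong₂ _,_ (add-sub -1ℤ a) (ℤ.+-inverseʳ b)
Δ-nb N (a , b) = cong₂ _,_ (ℤ.+-inverseʳ a) (add-sub 1ℤ b)
Δ-nb S (a , b) = cong₂ _,_ (ℤ.+-inverseʳ a) (add-sub -1ℤ b)

-- 'unit' has a left inverse, hence the direction of a step is determined by its endpoints.
unit⁻¹ : V → Dir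
unit⁻¹ (+ suc zero , _) = E
unit⁻¹ (-[1+ zero ] , _) = W
unit⁻¹ (_ , + suc zero) = N
unit⁻¹ _ = S

unit⁻¹-unit : ∀ d → unit⁻¹ (unit d) ≡ d
unit⁻¹-unit E = refl
unit⁻¹-unit W = refl
unit⁻¹-unit N = refl
unit⁻¹-unit S = refl

nb-injective : ∀ {d d'} u → nb d u ≡ nb d' u → d ≡ d'
nb-injective {d} {d'} u eq = begin
  d                         ≡⟨ sym (unit⁻¹-unit d) ⟩
  unit⁻¹ (unit d)           ≡⟨ cong unit⁻¹ (sym (Δ-nb d u)) ⟩
  unit⁻¹ (Δ (nb d u) u)     ≡⟨ cong (λ w → unit⁻¹ (Δ w u)) eq ⟩
  unit⁻¹ (Δ (nb d' u) u)    ≡⟨ cong unit⁻¹ (Δ-nb d' u) ⟩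
  unit⁻¹ (unit d')          ≡⟨ unit⁻¹-unit d' ⟩
  d'                        ∎
  where open ≡-Reasoning

no-U-turn : ∀ {d e} u → nb e (nb d u) ≡ u → e ≡ opp d
no-U-turn {d} u eq = nb-injective (nb d u) (trans eq (sym (nb-opp d u)))

nb-cancel : ∀ d {u w} → nb d u ≡ nb d w → u ≡ w
nb-cancel d {u} {w} eq = trans (sym (nb-opp d u)) (trans (cong (nb (opp d)) eq) (nb-opp d w))

parityℤ : ℤ → Parity
parityℤ x = parity ∣ x ∣

parity-suc : ∀ n → parity (suc n) ≡ parity n ⁻¹
parity-suc n = trans (sym (⁻¹-involutive _)) (cong _⁻¹ (suc-homo-⁻¹ n))

parityℤ-suc : ∀ x → parityℤ (1ℤ ℤ.+ x) ≡ parityℤ x ⁻¹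
parityℤ-suc (+ n) = parity-suc n
parityℤ-suc -[1+ zero ] = refl
parityℤ-suc -[1+ suc n ] = parity-suc n

parityℤ-pred : ∀ x → parityℤ (-1ℤ ℤ.+ x) ≡ parityℤ x ⁻¹
parityℤ-pred x = begin
  parityℤ (-1ℤ ℤ.+ x)                 ≡⟨ sym (⁻¹-involutive _) ⟩
  parityℤ (-1ℤ ℤ.+ x) ⁻¹ ⁻¹           ≡⟨ cong _⁻¹ (sym (parityℤ-suc (-1ℤ ℤ.+ x))) ⟩
  parityℤ (1ℤ ℤ.+ (-1ℤ ℤ.+ x)) ⁻¹     ≡⟨ cong (λ y → parityℤ y ⁻¹) (suc∘pred x) ⟩
  parityℤ x ⁻¹                        ∎
  where open ≡-Reasoning

colour : V → Parity
colour (a , b) = parityℤ (a ℤ.+ b)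

colour-nb : ∀ d u → colour (nb d u) ≡ colour u ⁻¹
colour-nb E (a , b) = trans (cong parityℤ (ℤ.+-assoc 1ℤ a b)) (parityℤ-suc (a ℤ.+ b))
colour-nb W (a , b) = trans (cong parityℤ (ℤ.+-assoc -1ℤ a b)) (parityℤ-pred (a ℤ.+ b))
colour-nb N (a , b) = trans (cong parityℤ (swap 1ℤ a b)) (parityℤ-suc (a ℤ.+ b))
  where swap : ∀ k a b → a ℤ.+ (k ℤ.+ b) ≡ k ℤ.+ (a ℤ.+ b)
        swap = solve-∀
colour-nb S (a , b) = trans (cong parityℤ (swap -1ℤ a b)) (parityℤ-pred (a ℤ.+ b))
  where swap : ∀ k a b → a ℤ.+ (k ℤ.+ b) ≡ k ℤ.+ (a ℤ.+ b)
        swap = solve-∀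

-- The grid is bipartite: no step is a loop, and two steps never equal one step.
nb≢self : ∀ d u → nb d u ≢ u
nb≢self d u eq = p≢p⁻¹ (colour u) (sym (trans (sym (colour-nb d u)) (cong colour eq)))

two-steps≢one-step : ∀ d e d' u → nb e (nb d u) ≢ nb d' u
two-steps≢one-step d e d' u eq = p≢p⁻¹ (colour u) (begin
  colour u                  ≡⟨ sym (⁻¹-involutive _) ⟩
  colour u ⁻¹ ⁻¹            ≡⟨ cong _⁻¹ (sym (colour-nb d u)) ⟩
  colour (nb d u) ⁻¹        ≡⟨ sym (colour-nb e (nb d u)) ⟩
  colour (nb e (nb d u))    ≡⟨ cong colour eq ⟩
  colour (nb d' u)          ≡⟨ colour-nb d' u ⟩
  colour u ⁻¹               ∎)
  where open ≡-Reasoning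

norm : V → ℕ
norm (x , y) = ∣ x ∣ + ∣ y ∣

∣x∣≡1 : ∀ x → ∣ x ∣ ≡ 1 → x ≡ 1ℤ ⊎ x ≡ -1ℤ
∣x∣≡1 (+ suc zero) _ = inj₁ refl
∣x∣≡1 -[1+ zero ] _ = inj₂ refl
∣x∣≡1 (+ zero) ()
∣x∣≡1 (+ suc (suc n)) ()
∣x∣≡1 -[1+ suc n ] ()

unit-vectors : ∀ p → norm p ≡ 1 → ∃ λ d → p ≡ unit d
unit-vectors (x , y) eq with ∣ x ∣ in ex | ∣ y ∣ in ey
... | 0 | 1 with ∣x∣≡1 y ey
...   | inj₁ refl = N , cong (_, 1ℤ) (ℤ.∣i∣≡0⇒i≡0 ex)
...   | inj₂ refl = S , cong (_, -1ℤ) (ℤ.∣i∣≡0⇒i≡0 ex)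
unit-vectors (x , y) eq | 1 | 0 with ∣x∣≡1 x ex
...   | inj₁ refl = E , cong (1ℤ ,_) (ℤ.∣i∣≡0⇒i≡0 ey)
...   | inj₂ refl = W , cong (-1ℤ ,_) (ℤ.∣i∣≡0⇒i≡0 ey)
unit-vectors (x , y) () | 0 | 0
unit-vectors (x , y) () | 0 | suc (suc _)
unit-vectors (x , y) () | 1 | suc _
unit-vectors (x , y) () | suc (suc _) | _

Δ-toward : ∀ d u → Δ u (nb d u) ≡ unit (opp d)
Δ-toward d u = begin
  Δ u (nb d u)                        ≡⟨ cong (λ w → Δ w (nb d u)) (sym (nb-opp d u)) ⟩
  Δ (nb (opp d) (nb d u)) (nb d u)    ≡⟨ Δ-nb (opp d) (nb d u) ⟩
  unit (opp d)                        ∎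
  where open ≡-Reasoning

Δ-cancel : ∀ u {w w'} → Δ u w ≡ Δ u w' → w ≡ w'
Δ-cancel (a , b) {c , d} {c' , d'} eq = cong₂ _,_ (cancel a (cong proj₁ eq)) (cancel b (cong proj₂ eq))
  where
  recover : ∀ a c → c ≡ a ℤ.- (a ℤ.- c)
  recover = solve-∀
  cancel : ∀ a {c c'} → a ℤ.- c ≡ a ℤ.- c' → c ≡ c'
  cancel a {c} {c'} e = trans (recover a c) (trans (cong (λ x → a ℤ.- x) e) (sym (recover a c')))

-- Abstract: no computation needs this proof, and keeping it folded keeps the out-degree
-- sums below cheap to typecheck.
abstract
  adj-nb : ∀ d u → Adj u (nb d u)
  adj-nb d u = subst (λ p → norm p ≡ 1) (sym (Δ-toward d u)) (unit-norm (opp d))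
    where
    unit-norm : ∀ d → norm (unit d) ≡ 1
    unit-norm E = refl
    unit-norm W = refl
    unit-norm N = refl
    unit-norm S = refl

adj⇒nb : ∀ u w → Adj u w → ∃ λ d → w ≡ nb d u
adj⇒nb u w adj with unit-vectors (Δ u w) adj
... | d , eq = opp d , Δ-cancel u (begin
  Δ u w                     ≡⟨ eq ⟩
  unit d                    ≡⟨ cong unit (sym (opp-involutive d)) ⟩
  unit (opp (opp d))        ≡⟨ sym (Δ-toward (opp d) u) ⟩
  Δ u (nb (opp d) u)        ∎)
  where open ≡-Reasoning

_≟V_ : (x y : V) → Dec (x ≡ y)
_≟V_ = Product.≡-dec ℤ._≟_ ℤ._≟_

module Run (O : Orientation) (v : V) (σ : Strategy) where
  open Process O v σ

  protected-after : ∀ {j t w} → j ≤ t → σ j ≡ just w → Protected (suc t) w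
  protected-after {t = t} j≤t e with m≤n⇒m<n∨m≡n j≤t
  ... | inj₂ refl = inj₂ e
  protected-after {t = suc t} j≤t e | inj₁ (s≤s j≤t') = inj₁ (protected-after j≤t' e)

  burn-step : ∀ {t x y} → Burning t x → Arc O x y → ¬ Protected (suc t) y → Burning (suc t) y
  burn-step bx arc np = inj₂ (np , _ , bx , arc)

  chooses? : ∀ t w → Dec (σ t ≡ just w)
  chooses? t w = Maybe.≡-dec _≟V_ (σ t) (just w)

  spare : ∀ {t y z} → y ≢ z → ¬ Protected t y → ¬ Protected t z →
          ¬ Protected (suc t) y ⊎ ¬ Protected (suc t) z
  spare {t} {y} {z} y≢z npy npz with chooses? t y
  ... | yes σ≡y = inj₂ λ { (inj₁ p) → npz p
                         ; (inj₂ σ≡z) → y≢z (just-injective (trans (sym σ≡y) σ≡z)) }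
  ... | no σ≢y = inj₁ λ { (inj₁ p) → npy p ; (inj₂ σ≡y) → σ≢y σ≡y }

  ignite : ∀ {t x y z} → Burning t x → y ≢ z → Arc O x y → Arc O x z →
           ¬ Protected t y → ¬ Protected t z → Burning (suc t) y ⊎ Burning (suc t) z
  ignite bx y≢z ay az npy npz = Sum.map (burn-step bx ay) (burn-step bx az) (spare y≢z npy npz)

columnDir : Parity → Dir
columnDir 0ℙ = S
columnDir 1ℙ = N

column : ℤ → Dir
column a = columnDir (parityℤ a)

column≢E : ∀ a → column a ≢ E
column≢E a with parityℤ a
... | 0ℙ = λ ()
... | 1ℙ = λ ()

column≢W : ∀ a → column a ≢ W
column≢W a with parityℤ a
... | 0ℙ = λ ()
... | 1ℙ = λ ()

column-pred : ∀ a → column (-1ℤ ℤ.+ a) ≡ opp (column a)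
column-pred a rewrite parityℤ-pred a with parityℤ a
... | 0ℙ = refl
... | 1ℙ = refl

column-keeps : ∀ a u → proj₁ (nb (column a) u) ≡ proj₁ u
column-keeps a u with parityℤ a
... | 0ℙ = refl
... | 1ℙ = refl

west-commutes : ∀ a u → nb W (nb (column a) u) ≡ nb (column a) (nb W u)
west-commutes a u with parityℤ a
... | 0ℙ = refl
... | 1ℙ = refl

Arc₀ : V → V → Set
Arc₀ u w = w ≡ nb W u ⊎ w ≡ nb (column (proj₁ u)) u

arc⇒adj₀ : ∀ u w → Arc₀ u w → Adj u w
arc⇒adj₀ u _ (inj₁ refl) = adj-nb W u
arc⇒adj₀ u _ (inj₂ refl) = adj-nb (column (proj₁ u)) u

orient-step : ∀ d u → Arc₀ u (nb d u) ⊎ Arc₀ (nb d u) u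
orient-step E u = inj₂ (inj₁ (sym (nb-opp E u)))
orient-step W u = inj₁ (inj₁ refl)
orient-step N u with parityℤ (proj₁ u)
... | 0ℙ = inj₂ (inj₂ (sym (nb-opp N u)))
... | 1ℙ = inj₁ (inj₂ refl)
orient-step S u with parityℤ (proj₁ u)
... | 0ℙ = inj₁ (inj₂ refl)
... | 1ℙ = inj₂ (inj₂ (sym (nb-opp S u)))

oriented₀ : ∀ u w → Adj u w → Arc₀ u w ⊎ Arc₀ w u
oriented₀ u w adj with adj⇒nb u w adj
... | d , refl = orient-step d u

-- No edge is oriented both ways: the step back would have to be a U-turn.
single₀ : ∀ u w → ¬ (Arc₀ u w × Arc₀ w u)
single₀ u _ (inj₁ refl , inj₁ back) with no-U-turn {W} {W} u (sym back)
... | ()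
single₀ u _ (inj₁ refl , inj₂ back) = column≢E a (no-U-turn {W} {column a} u (sym back))
  where a = -1ℤ ℤ.+ proj₁ u
single₀ u _ (inj₂ refl , inj₁ back) =
  column≢W (-1ℤ ℤ.+ proj₁ u) (trans (column-pred (proj₁ u)) (sym (no-U-turn u (sym back))))
single₀ u _ (inj₂ refl , inj₂ back) = opp≢ (column a) (sym (begin
  column a                                            ≡⟨ cong column (sym (column-keeps a u)) ⟩
  column (proj₁ (nb (column a) u))                    ≡⟨ no-U-turn u (sym back) ⟩
  opp (column a)                                      ∎))
  where
  open ≡-Reasoning
  a = proj₁ u

O₀ : Orientation
O₀ = record { Arc = Arc₀ ; arc⇒adj = arc⇒adj₀ ; oriented = oriented₀ ; single = single₀ }

-- The strategy from v = (x, y): with k the direction of column x, the fire can only spread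
-- from v to b = v + k, from b to c = b + W, and from c nowhere, after protecting
-- p₁ = v + W, p₂ = b + k and p₃ = c + W (c's other out-neighbour c + opp k is p₁).
module Westward (x y : ℤ) where
  k : Dir
  k = column x

  v b c p₁ p₂ p₃ : V
  v = (x , y)
  b = nb k v
  c = nb W b
  p₁ = nb W v
  p₂ = nb k b
  p₃ = nb W c

  σ : Strategy
  σ 0 = just p₁
  σ 1 = just p₂
  σ 2 = just p₃
  σ (suc (suc (suc _))) = nothing

  open Process O₀ v σ
  open Run O₀ v σ

  out-b : ∀ {w} → Arc₀ b w → w ≡ c ⊎ w ≡ p₂
  out-b = Sum.map₂ (λ e → trans e (cong (λ a → nb (column a) b) (column-keeps x v)))

  out-c : ∀ {w} → Arc₀ c w → w ≡ p₃ ⊎ w ≡ p₁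
  out-c = Sum.map₂ (λ e → trans e (begin
    nb (column (-1ℤ ℤ.+ proj₁ b)) c    ≡⟨ cong (λ a → nb (column (-1ℤ ℤ.+ a)) c) (column-keeps x v) ⟩
    nb (column (-1ℤ ℤ.+ x)) c          ≡⟨ cong (λ d → nb d c) (column-pred x) ⟩
    nb (opp k) (nb W (nb k v))         ≡⟨ cong (nb (opp k)) (west-commutes x v) ⟩
    nb (opp k) (nb k (nb W v))         ≡⟨ nb-opp k (nb W v) ⟩
    p₁                                 ∎))
    where open ≡-Reasoning

  Reached : ℕ → V → Set
  Reached t w = w ≡ v ⊎ (1 ≤ t × w ≡ b) ⊎ (2 ≤ t × w ≡ c)

  -- A newly burning vertex is an unprotected out-neighbour of v, b or c; all of these except
  -- b (from time 1) and c (from time 2) are protected by then.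
  reached : ∀ t w → Burning t w → Reached t w
  reached zero w refl = inj₁ refl
  reached (suc t) w (inj₁ burning) =
    Sum.map₂ (Sum.map (Product.map₁ m≤n⇒m≤1+n) (Product.map₁ m≤n⇒m≤1+n)) (reached t w burning)
  reached (suc t) w (inj₂ (np , y' , burning , arc)) with reached t y' burning
  ... | inj₁ refl = Sum.[ (λ { refl → ⊥-elim (np (protected-after z≤n refl)) }) ,
                          (λ w≡b → inj₂ (inj₁ (s≤s z≤n , w≡b))) ] arc
  ... | inj₂ (inj₁ (1≤t , refl)) = Sum.[ (λ w≡c → inj₂ (inj₂ (s≤s 1≤t , w≡c))) ,
                                         (λ { refl → ⊥-elim (np (protected-after 1≤t refl)) }) ] (out-b arc)
  ... | inj₂ (inj₂ (2≤t , refl)) = Sum.[ (λ { refl → ⊥-elim (np (protected-after 2≤t refl)) }) ,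
                                         (λ { refl → ⊥-elim (np (protected-after z≤n refl)) }) ] (out-c arc)

  at-most-three : AtMostBurn 3
  at-most-three = (v ∷ b ∷ c ∷ []) , ≤-refl , λ w (t , burning) → member (reached t w burning)
    where
    member : ∀ {t w} → Reached t w → w ∈ (v ∷ b ∷ c ∷ [])
    member (inj₁ w≡v) = here w≡v
    member (inj₂ (inj₁ (_ , w≡b))) = there (here w≡b)
    member (inj₂ (inj₂ (_ , w≡c))) = there (there (here w≡c))

  p₁≢v : p₁ ≢ v
  p₁≢v = nb≢self W v

  p₂≢v : p₂ ≢ v
  p₂≢v eq = opp≢ k (sym (no-U-turn v eq))

  p₂≢b : p₂ ≢ b
  p₂≢b = nb≢self k b

  p₂≢p₁ : p₂ ≢ p₁
  p₂≢p₁ = two-steps≢one-step k k W v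

  p₃≢v : p₃ ≢ v
  p₃≢v eq = two-steps≢one-step W W (opp k) b (trans eq (sym (nb-opp k v)))

  p₃≢b : p₃ ≢ b
  p₃≢b eq with no-U-turn {W} {W} b eq
  ... | ()

  p₃≢c : p₃ ≢ c
  p₃≢c = nb≢self W c

  p₃≢p₁ : p₃ ≢ p₁
  p₃≢p₁ eq = column≢W (-1ℤ ℤ.+ x) (trans (column-pred x) (sym (no-U-turn v (nb-cancel W eq))))

  p₃≢p₂ : p₃ ≢ p₂
  p₃≢p₂ = two-steps≢one-step W W k b

  valid : Valid
  valid 0 w refl = p₁≢v , λ ()
  valid 1 w refl = not-burning , λ { (inj₁ ())
                                   ; (inj₂ σ₀≡p₂) → p₂≢p₁ (sym (just-injective σ₀≡p₂)) }
    where
    not-burning : ¬ Burning 1 p₂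
    not-burning burning with reached 1 p₂ burning
    ... | inj₁ eq = p₂≢v eq
    ... | inj₂ (inj₁ (_ , eq)) = p₂≢b eq
    ... | inj₂ (inj₂ (s≤s () , _))
  valid 2 w refl = not-burning , not-protected
    where
    not-burning : ¬ Burning 2 p₃
    not-burning burning with reached 2 p₃ burning
    ... | inj₁ eq = p₃≢v eq
    ... | inj₂ (inj₁ (_ , eq)) = p₃≢b eq
    ... | inj₂ (inj₂ (_ , eq)) = p₃≢c eq
    not-protected : ¬ Protected 2 p₃
    not-protected (inj₁ (inj₂ σ₀≡p₃)) = p₃≢p₁ (sym (just-injective σ₀≡p₃))
    not-protected (inj₂ σ₁≡p₃) = p₃≢p₂ (sym (just-injective σ₁≡p₃))
  valid (suc (suc (suc t))) w ()

upper-bound : βAtMost O₀ 3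
upper-bound (x , y) = Westward.σ x y , Westward.valid x y , Westward.at-most-three x y

two-distinct : ∀ {A : Set} {xs : List A} → Unique xs → 2 ≤ length xs →
               Σ A λ x → Σ A λ y → x ≢ y × x ∈ xs × y ∈ xs
two-distinct {xs = x ∷ y ∷ _} ((x≢y ∷ _) ∷ _) _ = x , y , x≢y , here refl , there (here refl)
two-distinct {xs = []} _ ()
two-distinct {xs = _ ∷ []} _ (s≤s ())

three-distinct : ∀ {A : Set} {xs : List A} → Unique xs → 3 ≤ length xs →
                 Σ A λ x → Σ A λ y → Σ A λ z → x ≢ y × x ≢ z × y ≢ z × x ∈ xs × y ∈ xs × z ∈ xs
three-distinct {xs = x ∷ y ∷ z ∷ _} ((x≢y ∷ x≢z ∷ _) ∷ (y≢z ∷ _) ∷ _) _ =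
  x , y , z , x≢y , x≢z , y≢z , here refl , there (here refl) , there (there (here refl))
three-distinct {xs = []} _ ()
three-distinct {xs = _ ∷ []} _ (s≤s ())
three-distinct {xs = _ ∷ _ ∷ []} _ (s≤s (s≤s ()))

all-directions : ∀ {P : Dir → Set} {Q : Set} → (∀ d → P d ⊎ Q) → (∀ d → P d) ⊎ Q
all-directions {P} {Q} h with h E | h W | h N | h S
... | inj₁ pE | inj₁ pW | inj₁ pN | inj₁ pS = inj₁ λ { E → pE ; W → pW ; N → pN ; S → pS }
... | inj₂ q | _ | _ | _ = inj₂ q
... | _ | inj₂ q | _ | _ = inj₂ q
... | _ | _ | inj₂ q | _ = inj₂ q
... | _ | _ | _ | inj₂ q = inj₂ q

compass : List Dir
compass = E ∷ W ∷ N ∷ S ∷ []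

compass-unique : Unique compass
compass-unique = ((λ ()) ∷ (λ ()) ∷ (λ ()) ∷ []) ∷ ((λ ()) ∷ (λ ()) ∷ []) ∷ ((λ ()) ∷ []) ∷ [] ∷ []

module OutDegree (O : Orientation) where

  out? : ∀ u d → Dec (Arc O u (nb d u))
  out? u d with oriented O u (nb d u) (adj-nb d u)
  ... | inj₁ arc = yes arc
  ... | inj₂ arc = no λ arc' → single O u (nb d u) (arc' , arc)

  outDirs : V → List Dir
  outDirs u = filter (out? u) compass

  deg : V → ℕ
  deg u = length (outDirs u)

  outDirs-arc : ∀ {u d} → d ∈ outDirs u → Arc O u (nb d u)
  outDirs-arc {u} d∈ = proj₂ (∈-filter⁻ (out? u) d∈)

  two-out : ∀ u → 2 ≤ deg u →
            Σ Dir λ d₁ → Σ Dir λ d₂ → d₁ ≢ d₂ × Arc O u (nb d₁ u) × Arc O u (nb d₂ u)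
  two-out u le with two-distinct (filter⁺ (out? u) compass-unique) le
  ... | d₁ , d₂ , d₁≢d₂ , ∈₁ , ∈₂ = d₁ , d₂ , d₁≢d₂ , outDirs-arc ∈₁ , outDirs-arc ∈₂

  three-out : ∀ u → 3 ≤ deg u →
              Σ Dir λ d₁ → Σ Dir λ d₂ → Σ Dir λ d₃ → d₁ ≢ d₂ × d₁ ≢ d₃ × d₂ ≢ d₃ ×
              Arc O u (nb d₁ u) × Arc O u (nb d₂ u) × Arc O u (nb d₃ u)
  three-out u le with three-distinct (filter⁺ (out? u) compass-unique) le
  ... | d₁ , d₂ , d₃ , ≢₁₂ , ≢₁₃ , ≢₂₃ , ∈₁ , ∈₂ , ∈₃ =
    d₁ , d₂ , d₃ , ≢₁₂ , ≢₁₃ , ≢₂₃ , outDirs-arc ∈₁ , outDirs-arc ∈₂ , outDirs-arc ∈₃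

  Good : V → Set
  Good u = 3 ≤ deg u ⊎ (2 ≤ deg u × (∀ d → Arc O u (nb d u) → 2 ≤ deg (nb d u)))

module FromGoodVertex (O : Orientation) (v : V) (σ : Strategy) where
  open Process O v σ
  open Run O v σ
  open OutDegree O

  three-burnt : ∀ {x y z} → x ≢ y → x ≢ z → y ≢ z → Burnt x → Burnt y → Burnt z → AtLeastBurn 3
  three-burnt x≢y x≢z y≢z bx by bz =
    _ , refl , ((x≢y ∷ x≢z ∷ []) ∷ (y≢z ∷ []) ∷ [] ∷ []) , (bx ∷ by ∷ bz ∷ [])

  origin : Burnt v
  origin = 0 , refl

  v≢nb : ∀ d → v ≢ nb d v
  v≢nb d eq = nb≢self d v (sym eq)

  nb≢nb : ∀ {d d'} → d ≢ d' → nb d v ≢ nb d' v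
  nb≢nb d≢d' eq = d≢d' (nb-injective v eq)

  unprotected₀ : ∀ w → ¬ Protected 0 w
  unprotected₀ w ()

  unprotected₁ : ∀ {w} → σ 0 ≢ just w → ¬ Protected 1 w
  unprotected₁ σ≢w (inj₂ σ≡w) = σ≢w σ≡w

  chosen-elsewhere : ∀ {x y} → σ 0 ≡ just x → x ≢ y → σ 0 ≢ just y
  chosen-elsewhere σ≡x x≢y σ≡y = x≢y (just-injective (trans (sym σ≡x) σ≡y))

  burns-at-1 : ∀ {d} → Arc O v (nb d v) → σ 0 ≢ just (nb d v) → Burnt (nb d v)
  burns-at-1 arc σ≢ = 1 , burn-step refl arc (unprotected₁ σ≢)

  -- Three out-neighbours: one protection saves at most one of them.
  from-three : ∀ {d₁ d₂ d₃} → d₁ ≢ d₂ → d₁ ≢ d₃ → d₂ ≢ d₃ →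
               Arc O v (nb d₁ v) → Arc O v (nb d₂ v) → Arc O v (nb d₃ v) → AtLeastBurn 3
  from-three {d₁} {d₂} {d₃} ≢₁₂ ≢₁₃ ≢₂₃ a₁ a₂ a₃ with chooses? 0 (nb d₁ v)
  ... | yes σ≡₁ = three-burnt (v≢nb d₂) (v≢nb d₃) (nb≢nb ≢₂₃) origin
                    (burns-at-1 a₂ (chosen-elsewhere σ≡₁ (nb≢nb ≢₁₂)))
                    (burns-at-1 a₃ (chosen-elsewhere σ≡₁ (nb≢nb ≢₁₃)))
  ... | no σ≢₁ with ignite refl (nb≢nb ≢₂₃) a₂ a₃ (unprotected₀ (nb d₂ v)) (unprotected₀ (nb d₃ v))
  ...   | inj₁ b₂ = three-burnt (v≢nb d₁) (v≢nb d₂) (nb≢nb ≢₁₂) origin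
                      (burns-at-1 a₁ σ≢₁) (1 , b₂)
  ...   | inj₂ b₃ = three-burnt (v≢nb d₁) (v≢nb d₃) (nb≢nb ≢₁₃) origin
                      (burns-at-1 a₁ σ≢₁) (1 , b₃)

  -- The out-neighbour in direction d is protected at time 0, so the one in direction d'
  -- burns; it has two out-neighbours, and one of them burns at time 2.
  from-chase : ∀ {d d'} → σ 0 ≡ just (nb d v) → d ≢ d' → Arc O v (nb d' v) → 2 ≤ deg (nb d' v) →
               AtLeastBurn 3
  from-chase {d} {d'} σ≡ d≢d' a' deg≥2 with two-out b deg≥2
    where b = nb d' v
  ... | e₁ , e₂ , e₁≢e₂ , a₁ , a₂ =
    Sum.[ second-generation a₁ , second-generation a₂ ]
      (ignite burning-b (λ eq → e₁≢e₂ (nb-injective b eq)) a₁ a₂ (fresh e₁) (fresh e₂))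
    where
    b : V
    b = nb d' v

    burning-b : Burning 1 b
    burning-b = burn-step refl a' (unprotected₁ (chosen-elsewhere σ≡ (nb≢nb d≢d')))

    -- Vertices two steps from v were not chosen at time 0, which was one step from v.
    fresh : ∀ e → ¬ Protected 1 (nb e b)
    fresh e = unprotected₁ (chosen-elsewhere σ≡ (λ eq → two-steps≢one-step d' e d v (sym eq)))

    second-generation : ∀ {e} → Arc O b (nb e b) → Burning 2 (nb e b) → AtLeastBurn 3
    second-generation {e} arc burning = three-burnt (v≢nb d') v≢c (λ eq → nb≢self e b (sym eq))
                                          origin (1 , burning-b) (2 , burning)
      where
      v≢c : v ≢ nb e b
      v≢c eq = single O v b (a' , subst (Arc O b) (sym eq) arc)

  -- Out-degree ≥ 3 is handled by from-three; otherwise either both out-neighbours burn at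
  -- time 1, or the protected one is chased by from-chase.
  good⇒three : Good v → AtLeastBurn 3
  good⇒three (inj₁ deg≥3) with three-out v deg≥3
  ... | _ , _ , _ , ≢₁₂ , ≢₁₃ , ≢₂₃ , a₁ , a₂ , a₃ = from-three ≢₁₂ ≢₁₃ ≢₂₃ a₁ a₂ a₃
  good⇒three (inj₂ (deg≥2 , out-nbrs)) with two-out v deg≥2
  ... | d₁ , d₂ , d₁≢d₂ , a₁ , a₂ with chooses? 0 (nb d₁ v)
  ...   | yes σ≡₁ = from-chase σ≡₁ d₁≢d₂ a₂ (out-nbrs d₂ a₂)
  ...   | no σ≢₁ with chooses? 0 (nb d₂ v)
  ...     | yes σ≡₂ = from-chase σ≡₂ (λ eq → d₁≢d₂ (sym eq)) a₁ (out-nbrs d₁ a₁)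
  ...     | no σ≢₂ = three-burnt (v≢nb d₁) (v≢nb d₂) (nb≢nb d₁≢d₂) origin
                       (burns-at-1 a₁ σ≢₁) (burns-at-1 a₂ σ≢₂)

sum : ℕ → (ℕ → ℕ) → ℕ
sum zero f = 0
sum (suc n) f = f 0 + sum n (λ i → f (suc i))

sum-+ : ∀ n f g → sum n (λ i → f i + g i) ≡ sum n f + sum n g
sum-+ zero f g = refl
sum-+ (suc n) f g =
  trans (cong (λ s → f 0 + g 0 + s) (sum-+ n (λ i → f (suc i)) (λ i → g (suc i))))
        (interchange (f 0) (g 0) _ _)

sum-mono : ∀ n {f g} → (∀ i → i < n → f i ≤ g i) → sum n f ≤ sum n g
sum-mono zero h = z≤n
sum-mono (suc n) h = +-mono-≤ (h 0 (s≤s z≤n)) (sum-mono n (λ i i<n → h (suc i) (s≤s i<n)))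

sum-cong : ∀ n {f g} → (∀ i → i < n → f i ≡ g i) → sum n f ≡ sum n g
sum-cong n h = ≤-antisym (sum-mono n (λ i i<n → ≤-reflexive (h i i<n)))
                         (sum-mono n (λ i i<n → ≤-reflexive (sym (h i i<n))))

sum-const : ∀ n c → sum n (λ _ → c) ≡ n * c
sum-const zero c = refl
sum-const (suc n) c = cong (λ s → c + s) (sum-const n c)

sum-window : ∀ a k n f → a + k ≤ n → sum k (λ i → f (a + i)) ≤ sum n f
sum-window zero zero n f _ = z≤n
sum-window zero (suc k) (suc n) f (s≤s k≤n) = +-monoʳ-≤ (f 0) (sum-window zero k n (λ i → f (suc i)) k≤n)
sum-window (suc a) k (suc n) f (s≤s a+k≤n) =
  ≤-trans (sum-window a k n (λ i → f (suc i)) a+k≤n) (m≤n+m _ (f 0))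

sum-pairs : ∀ m c e w → (∀ i → c ≤ e i + w (suc i)) → m * c ≤ sum (suc m) e + sum (suc m) w
sum-pairs m c e w pair = begin
  m * c                                   ≡⟨ sym (sum-const m c) ⟩
  sum m (λ _ → c)                         ≤⟨ sum-mono m (λ i _ → pair i) ⟩
  sum m (λ i → e i + w (suc i))           ≡⟨ sum-+ m e (λ i → w (suc i)) ⟩
  sum m e + sum m (λ i → w (suc i))       ≤⟨ +-mono-≤ (sum-window 0 m (suc m) e (n≤1+n m)) (m≤n+m _ (w 0)) ⟩
  sum (suc m) e + sum (suc m) w           ∎
  where open ≤-Reasoning

square : ℕ → (ℕ → ℕ → ℕ) → ℕ
square n g = sum n (λ i → sum n (g i))

square-+ : ∀ n f g → square n (λ i j → f i j + g i j) ≡ square n f + square n g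
square-+ n f g = trans (sum-cong n (λ i _ → sum-+ n (f i) (g i))) (sum-+ n _ _)

square-mono : ∀ n {f g} → (∀ i j → i < n → j < n → f i j ≤ g i j) → square n f ≤ square n g
square-mono n h = sum-mono n (λ i i<n → sum-mono n (λ j j<n → h i j i<n j<n))

square-const : ∀ n c → square n (λ _ _ → c) ≡ n * (n * c)
square-const n c = trans (sum-cong n (λ _ _ → sum-const n c)) (sum-const n (n * c))

square-window : ∀ a b k n g → a + k ≤ n → b + k ≤ n →
                square k (λ i j → g (a + i) (b + j)) ≤ square n g
square-window a b k n g a+k≤n b+k≤n =
  ≤-trans (sum-mono k (λ i _ → sum-window b k n (g (a + i)) b+k≤n))
          (sum-window a k n (λ i → sum n (g i)) a+k≤n)

-- The sum of g over the cross {(i,j), (i±1,j), (i,j±1)} centred at (i+1, j+1).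
cross : (ℕ → ℕ → ℕ) → ℕ → ℕ → ℕ
cross g i j = g (1 + i) (1 + j) + g (2 + i) (1 + j) + g i (1 + j) + g (1 + i) (2 + j) + g (1 + i) j

-- Each of the five cross positions runs over a window of [0,k+2)², so summing the crosses
-- over [0,k)² counts each value of g at most five times.
cross-sum : ∀ k g → let Σg = square (2 + k) g in square k (cross g) ≤ Σg + Σg + Σg + Σg + Σg
cross-sum k g =
  split (split (split (split (window 1 1 1≤2 1≤2) (window 2 1 ≤-refl 1≤2)) (window 0 1 z≤n 1≤2))
                      (window 1 2 1≤2 ≤-refl)) (window 1 0 1≤2 z≤n)
  where
  1≤2 : 1 ≤ 2
  1≤2 = s≤s z≤n
  window : ∀ a b → a ≤ 2 → b ≤ 2 → square k (λ i j → g (a + i) (b + j)) ≤ square (2 + k) g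
  window a b a≤2 b≤2 = square-window a b k (2 + k) g (+-monoˡ-≤ k a≤2) (+-monoˡ-≤ k b≤2)
  split : ∀ {f h A B} → square k f ≤ A → square k h ≤ B → square k (λ i j → f i j + h i j) ≤ A + B
  split {f} {h} f≤A h≤B = ≤-trans (≤-reflexive (square-+ k f h)) (+-mono-≤ f≤A h≤B)

length-filter-∷ : ∀ {A : Set} {P : A → Set} (P? : ∀ x → Dec (P x)) x xs →
                  length (filter P? (x ∷ xs)) ≡ length (filter P? (x ∷ [])) + length (filter P? xs)
length-filter-∷ P? x xs with P? x
... | yes _ = refl
... | no _ = refl

search : ∀ {P Q : ℕ → Set} → (∀ i → P i ⊎ Q i) → ∀ n → Σ ℕ P ⊎ (∀ i → i < n → Q i)
search p-or-q zero = inj₂ λ i ()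
search p-or-q (suc n) with search p-or-q n | p-or-q n
... | inj₁ found | _ = inj₁ found
... | inj₂ _ | inj₁ pn = inj₁ (n , pn)
... | inj₂ below | inj₂ qn = inj₂ λ i i<1+n → case m≤n⇒m<n∨m≡n (≤-pred i<1+n) of λ
  { (inj₁ i<n) → below i i<n
  ; (inj₂ refl) → qn }

module Discharging (O : Orientation) where
  open OutDegree O

  arcs : V → Dir → ℕ
  arcs u d = length (filter (out? u) (d ∷ []))

  deg-split : ∀ u → deg u ≡ (arcs u E + arcs u W) + (arcs u N + arcs u S)
  deg-split u = begin
    deg u                                         ≡⟨ length-filter-∷ (out? u) E _ ⟩
    arcs u E + length (filter (out? u) (W ∷ N ∷ S ∷ []))
      ≡⟨ cong (λ s → arcs u E + s) (length-filter-∷ (out? u) W _) ⟩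
    arcs u E + (arcs u W + length (filter (out? u) (N ∷ S ∷ [])))
      ≡⟨ cong (λ s → arcs u E + (arcs u W + s)) (length-filter-∷ (out? u) N _) ⟩
    arcs u E + (arcs u W + (arcs u N + arcs u S)) ≡⟨ sym (+-assoc (arcs u E) _ _) ⟩
    (arcs u E + arcs u W) + (arcs u N + arcs u S) ∎
    where open ≡-Reasoning

  edge-out : ∀ u d → 1 ≤ arcs u d + arcs (nb d u) (opp d)
  edge-out u d with out? u d
  ... | yes _ = s≤s z≤n
  ... | no ¬arc with oriented O u (nb d u) (adj-nb d u)
  ...   | inj₁ arc = ⊥-elim (¬arc arc)
  ...   | inj₂ arc with out? (nb d u) (opp d)
  ...     | yes _ = s≤s z≤n
  ...     | no ¬arc' = ⊥-elim (¬arc' (subst (Arc O (nb d u)) (sym (nb-opp d u)) arc))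

  pt : ℕ → ℕ → V
  pt i j = (+ i , + j)

  -- Counting the edges of the square [0,m]²: m(m+1) horizontal and (m+1)m vertical ones,
  -- each contributing an out-arc at one of its endpoints.
  horizontal-edges : ∀ m → m * suc m ≤ square (suc m) (λ i j → arcs (pt i j) E + arcs (pt i j) W)
  horizontal-edges m = begin
    m * suc m                             ≤⟨ sum-pairs m (suc m) east west row ⟩
    sum (suc m) east + sum (suc m) west   ≡⟨ sym (sum-+ (suc m) east west) ⟩
    sum (suc m) (λ i → east i + west i)
      ≡⟨ sum-cong (suc m) (λ i _ → sym (sum-+ (suc m) (λ j → arcs (pt i j) E) (λ j → arcs (pt i j) W))) ⟩
    square (suc m) (λ i j → arcs (pt i j) E + arcs (pt i j) W) ∎
    where
    open ≤-Reasoning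
    east west : ℕ → ℕ
    east i = sum (suc m) (λ j → arcs (pt i j) E)
    west i = sum (suc m) (λ j → arcs (pt i j) W)
    row : ∀ i → suc m ≤ east i + west (suc i)
    row i = begin
      suc m                      ≡⟨ sym (trans (sum-const (suc m) 1) (*-identityʳ (suc m))) ⟩
      sum (suc m) (λ _ → 1)      ≤⟨ sum-mono (suc m) (λ j _ → edge-out (pt i j) E) ⟩
      sum (suc m) (λ j → arcs (pt i j) E + arcs (pt (suc i) j) W)
        ≡⟨ sum-+ (suc m) (λ j → arcs (pt i j) E) (λ j → arcs (pt (suc i) j) W) ⟩
      east i + west (suc i)      ∎

  vertical-edges : ∀ m → suc m * m ≤ square (suc m) (λ i j → arcs (pt i j) N + arcs (pt i j) S)
  vertical-edges m = begin
    suc m * m                    ≡⟨ cong (suc m *_) (sym (*-identityʳ m)) ⟩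
    suc m * (m * 1)              ≡⟨ sym (sum-const (suc m) (m * 1)) ⟩
    sum (suc m) (λ _ → m * 1)    ≤⟨ sum-mono (suc m) (λ i _ → in-column i) ⟩
    square (suc m) (λ i j → arcs (pt i j) N + arcs (pt i j) S) ∎
    where
    open ≤-Reasoning
    in-column : ∀ i → m * 1 ≤ sum (suc m) (λ j → arcs (pt i j) N + arcs (pt i j) S)
    in-column i = ≤-trans (sum-pairs m 1 north south (λ j → edge-out (pt i j) N))
                       (≤-reflexive (sym (sum-+ (suc m) north south)))
      where
      north south : ℕ → ℕ
      north j = arcs (pt i j) N
      south j = arcs (pt i j) S

  degree-sum : ∀ m → m * suc m + suc m * m ≤ square (suc m) (λ i j → deg (pt i j))
  degree-sum m = begin
    m * suc m + suc m * m   ≤⟨ +-mono-≤ (horizontal-edges m) (vertical-edges m) ⟩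
    square (suc m) (λ i j → arcs (pt i j) E + arcs (pt i j) W)
      + square (suc m) (λ i j → arcs (pt i j) N + arcs (pt i j) S)
      ≡⟨ sym (square-+ (suc m) (λ i j → arcs (pt i j) E + arcs (pt i j) W)
                               (λ i j → arcs (pt i j) N + arcs (pt i j) S)) ⟩
    square (suc m) (λ i j → (arcs (pt i j) E + arcs (pt i j) W) + (arcs (pt i j) N + arcs (pt i j) S))
      ≡⟨ sum-cong (suc m) (λ i _ → sum-cong (suc m) (λ j _ → sym (deg-split (pt i j)))) ⟩
    square (suc m) (λ i j → deg (pt i j)) ∎
    where open ≤-Reasoning

  -- The deficit of out-degree below the average 2, and its sum over a closed neighbourhood.
  φ : V → ℕ
  φ u = 2 ∸ deg u

  local : V → ℕ
  local u = φ u + φ (nb E u) + φ (nb W u) + φ (nb N u) + φ (nb S u)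

  φ≤local : ∀ u → φ u ≤ local u
  φ≤local u = m≤n⇒m≤n+o (φ (nb S u)) (m≤n⇒m≤n+o (φ (nb N u)) (m≤n⇒m≤n+o (φ (nb W u))
                (m≤m+n (φ u) (φ (nb E u)))))

  φ-nb≤local : ∀ d u → φ (nb d u) ≤ local u
  φ-nb≤local E u = m≤n⇒m≤n+o (φ (nb S u)) (m≤n⇒m≤n+o (φ (nb N u)) (m≤n⇒m≤n+o (φ (nb W u))
                     (m≤n+m (φ (nb E u)) (φ u))))
  φ-nb≤local W u = m≤n⇒m≤n+o (φ (nb S u)) (m≤n⇒m≤n+o (φ (nb N u))
                     (m≤n+m (φ (nb W u)) (φ u + φ (nb E u))))
  φ-nb≤local N u = m≤n⇒m≤n+o (φ (nb S u)) (m≤n+m (φ (nb N u)) (φ u + φ (nb E u) + φ (nb W u)))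
  φ-nb≤local S u = m≤n+m (φ (nb S u)) (φ u + φ (nb E u) + φ (nb W u) + φ (nb N u))

  deficit : ∀ u → deg u ≤ 1 → 1 ≤ φ u
  deficit u deg≤1 = ∸-monoʳ-≤ 2 deg≤1

  Bad : V → Set
  Bad u = deg u ≤ 2 × 1 ≤ local u

  good-or-bad : ∀ u → Good u ⊎ Bad u
  good-or-bad u with 3 ≤? deg u
  ... | yes deg≥3 = inj₁ (inj₁ deg≥3)
  ... | no deg≱3 with 2 ≤? deg u
  ...   | no deg≱2 = inj₂ (deg≤2 , ≤-trans (deficit u (≤-pred (≰⇒> deg≱2))) (φ≤local u))
    where deg≤2 = ≤-pred (≰⇒> deg≱3)
  ...   | yes deg≥2 = Sum.map (λ nbrs → inj₂ (deg≥2 , λ d _ → nbrs d)) (deg≤2 ,_) (all-directions check)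
    where
    deg≤2 : deg u ≤ 2
    deg≤2 = ≤-pred (≰⇒> deg≱3)
    check : ∀ d → 2 ≤ deg (nb d u) ⊎ 1 ≤ local u
    check d with 2 ≤? deg (nb d u)
    ... | yes ≥2 = inj₁ ≥2
    ... | no ≱2 = inj₂ (≤-trans (deficit (nb d u) (≤-pred (≰⇒> ≱2))) (φ-nb≤local d u))

  pred-pos : ∀ i → -1ℤ ℤ.+ + suc i ≡ + i
  pred-pos zero = refl
  pred-pos (suc i) = refl

  local-cross : ∀ i j → local (pt (suc i) (suc j)) ≡ cross (λ i j → φ (pt i j)) i j
  local-cross i j rewrite pred-pos i | pred-pos j = refl

  -- If all out-degrees in the square [0,m]² are at most 2, then the total deficit there is
  -- at most 2(m+1): out-degrees sum to 2(m+1)² minus the deficit, and to at least 2m(m+1).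
  deficit-total : ∀ m → (∀ i j → i < suc m → j < suc m → deg (pt i j) ≤ 2) →
                  square (suc m) (λ i j → φ (pt i j)) ≤ 2 * suc m
  deficit-total m deg≤2 = +-cancelʳ-≤ edges _ _ (begin
    Φ + edges                ≤⟨ +-monoʳ-≤ Φ (degree-sum m) ⟩
    Φ + D                    ≡⟨ sym (square-+ (suc m) (λ i j → φ (pt i j)) (λ i j → deg (pt i j))) ⟩
    square (suc m) (λ i j → φ (pt i j) + deg (pt i j))
      ≡⟨ sum-cong (suc m) (λ i i< → sum-cong (suc m) (λ j j< → m∸n+n≡m (deg≤2 i j i< j<))) ⟩
    square (suc m) (λ _ _ → 2) ≡⟨ square-const (suc m) 2 ⟩
    suc m * (suc m * 2)      ≡⟨ area m ⟩
    2 * suc m + edges        ∎)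
    where
    open ≤-Reasoning
    Φ D edges : ℕ
    Φ = square (suc m) (λ i j → φ (pt i j))
    D = square (suc m) (λ i j → deg (pt i j))
    edges = m * suc m + suc m * m
    area : ∀ m → suc m * (suc m * 2) ≡ 2 * suc m + (m * suc m + suc m * m)
    area = ℕ-solve-∀

  bad-square : ∀ k → (∀ i j → i < 2 + k → j < 2 + k → Bad (pt i j)) →
               k * (k * 1) ≤ 2 * (2 + k) + 2 * (2 + k) + 2 * (2 + k) + 2 * (2 + k) + 2 * (2 + k)
  bad-square k bad = begin
    k * (k * 1)                                        ≡⟨ sym (square-const k 1) ⟩
    square k (λ _ _ → 1)                               ≤⟨ square-mono k (λ i j i<k j<k →
                                                            proj₂ (bad (suc i) (suc j) (inner i<k) (inner j<k))) ⟩
    square k (λ i j → local (pt (suc i) (suc j)))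
      ≡⟨ sum-cong k (λ i _ → sum-cong k (λ j _ → local-cross i j)) ⟩
    square k (cross g)                                 ≤⟨ cross-sum k g ⟩
    Φ + Φ + Φ + Φ + Φ
      ≤⟨ +-mono-≤ (+-mono-≤ (+-mono-≤ (+-mono-≤ Φ≤ Φ≤) Φ≤) Φ≤) Φ≤ ⟩
    2 * (2 + k) + 2 * (2 + k) + 2 * (2 + k) + 2 * (2 + k) + 2 * (2 + k) ∎
    where
    open ≤-Reasoning
    g : ℕ → ℕ → ℕ
    g i j = φ (pt i j)
    Φ : ℕ
    Φ = square (2 + k) g
    Φ≤ : Φ ≤ 2 * (2 + k)
    Φ≤ = deficit-total (suc k) (λ i j i< j< → proj₁ (bad i j i< j<))
    inner : ∀ {i} → i < k → suc i < 2 + k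
    inner i<k = s≤s (m≤n⇒m≤1+n i<k)

  good-vertex : Σ V Good
  good-vertex with search (λ i → search (λ j → good-or-bad (pt i j)) 14) 14
  ... | inj₁ (i , j , good) = pt i j , good
  ... | inj₂ all-bad = ⊥-elim (m+1+n≰m 140 {3} (bad-square 12 (λ i j i<14 j<14 → all-bad i i<14 j j<14)))

lower-bound : ∀ O → βAtLeast O 3
lower-bound O with Discharging.good-vertex O
... | v , good = v , λ σ _ → FromGoodVertex.good⇒three O v σ good

proposition5p14 : Σ Orientation (λ O → βAtMost O 3) × (∀ O → βAtLeast O 3)
proposition5p14 = (O₀ , upper-bound) , lower-bound
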